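{- Let $G$ be a finite group, let $S \subseteq G$ with $1 \notin S$ and $S^{ -1} = S$, and let $C \subseteq G$ be closed under conjugation (i.e. $xCx^{ -1} = C$ for all $x \in G$). Then the following are equivalent: (a) $C$ is a total perfect code in $\mathrm{Cay}(G, S)$; (b) there exists a pseudocovering $p: \mathrm{Cay}(G, S) \to K_{|S|}$ such that $gC$ is a fibre of $p$ for at least one element $g \in S$; (c) $|C|\,|S| = |G|$ and $C \cap \big((S^2 \setminus \{1\})C\big) = \emptyset$.
   Context: For a finite group $G$ and $S \subseteq G$ with $1 \notin S$ and $S^{ -1}=S$, the Cayley graph $\mathrm{Cay}(G,S)$ has vertex set $G$, with $x, y$ adjacent iff $xy^{ -1} \in S$. $S^2 = \{gg' : g, g' \in S\}$, and for $X, Y \subseteq G$, $XY = \{xy: x\in X, y \in Y\}$. A total perfect code in a graph is a set $C$ of vertices such that every vertex is adjacent to exactly one vertex of $C$. $K_n$ is the complete graph on $n$ vertices. A covering projection from $\Sigma$ to $\Gamma$ is a surjective map $p: V(\Sigma)\to V(\Gamma)$ whose restriction to each neighbourhood $\Sigma(u)$ is a bijection onto $\Gamma(p(u))$. A pseudocovering $p: \Sigma \to \Gamma$ is a surjective map $p: V(\Sigma) \to V(\Gamma)$ such that for each $v \in V(\Gamma)$ the induced subgraph $\Sigma[p^{ -1}(v)]$ is a matching (each vertex of $p^{ -1}(v)$ has exactly one neighbour in $p^{ -1}(v)$), and $p$ is a covering projection from $\Sigma^*$ to $\Gamma$, where $\Sigma^*$ is obtained from $\Sigma$ by deleting the edges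 inside each fibre; the sets $p^{ -1}(v)$ are the fibres of $p$. -}

module Defs where

open import Level using (0ℓ)
open import Data.Nat using (ℕ; _*_)
open import Data.Fin using (Fin)
open import Data.Fin.Subset using (Subset; _∈_; ∣_∣)
open import Data.Product using (Σ; _×_; _,_; ∃; ∃-syntax)
open import Relation.Nullary using (¬_)
open import Relation.Binary.PropositionalEquality using (_≡_; _≢_)
open import Function.Bundles using (_⇔_)
open import Algebra.Structures using (IsGroup)

record FiniteGroup : Set where
  field
    order   : ℕ
    _∙_     : Fin order → Fin order → Fin order
    ε       : Fin order
    _⁻¹     : Fin order → Fin order
    isGroup : IsGroup (_≡_ {A = Fin order}) _∙_ ε _⁻¹
  infixl 7 _∙_
  infix 8 _⁻¹

  Elt : Set
  Elt = Fin order

  Sub : Set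
  Sub = Subset order

  CayAdj : Sub → Elt → Elt → Set
  CayAdj S x y = (x ∙ (y ⁻¹)) ∈ S

  _∈[_·_] : Elt → Elt → Sub → Set
  x ∈[ g · C ] = ∃[ c ] (c ∈ C × x ≡ g ∙ c)

  _∈conj[_,_] : Elt → Elt → Sub → Set
  y ∈conj[ x , C ] = ∃[ c ] (c ∈ C × y ≡ (x ∙ c) ∙ (x ⁻¹))

  IsConnectionSet : Sub → Set
  IsConnectionSet S = (¬ ε ∈ S) × (∀ x → (x ∈ S ⇔ (x ⁻¹) ∈ S))

  ConjClosed : Sub → Set
  ConjClosed C = ∀ x y → (y ∈ C ⇔ y ∈conj[ x , C ])

  IsTotalPerfectCode : Sub → Sub → Set
  IsTotalPerfectCode S C =
    ∀ v → ∃[ c ] (c ∈ C × CayAdj S v c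
                  × (∀ c' → c' ∈ C → CayAdj S v c' → c' ≡ c))

  -- Pseudocovering p : Cay(G,S) → K_m  (K_m : vertices Fin m, i ~ j iff i ≢ j)
  record IsPseudocovering (S : Sub) (m : ℕ) (p : Elt → Fin m) : Set where
    -- adjacency in Σ* : delete edges inside fibres
    Adj* : Elt → Elt → Set
    Adj* u w = CayAdj S u w × p u ≢ p w
    field
      surjective : ∀ (j : Fin m) → ∃[ u ] (p u ≡ j)
      -- each fibre induces a matching
      matching   : ∀ u → ∃[ w ] (CayAdj S u w × p w ≡ p u
                      × (∀ w' → CayAdj S u w' → p w' ≡ p u → w' ≡ w))
      -- p restricted to Σ*(u) is a bijection onto K_m(p u)
      locInj     : ∀ u w w' → Adj* u w → Adj* u w' → p w ≡ p w' → w ≡ w'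
      locSurj    : ∀ u (j : Fin m) → j ≢ p u → ∃[ w ] (Adj* u w × p w ≡ j)

  IsFibre : ∀ {m} → (Elt → Set) → (Elt → Fin m) → Set
  IsFibre X p = ∃[ v ] (∀ x → (X x ⇔ p x ≡ v))

  HasPseudocoveringWithFibre : Sub → Sub → Set
  HasPseudocoveringWithFibre S C =
    ∃[ p ] (IsPseudocovering S ∣ S ∣ p
            × ∃[ g ] (g ∈ S × IsFibre (λ x → x ∈[ g · C ]) p))

  CountingCondition : Sub → Sub → Set
  CountingCondition S C =
    (∣ C ∣ * ∣ S ∣ ≡ order)
    × (¬ (∃[ x ] (x ∈ C × ∃[ s ] ∃[ t ] ∃[ c ]
          (s ∈ S × t ∈ S × s ∙ t ≢ ε × c ∈ C × x ≡ (s ∙ t) ∙ c))))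

-- A vertex v is adjacent to c iff v ∈ Sc, so (a) says that multiplication
-- S × C → G is bijective.  As S = S⁻¹, its injectivity is the disjointness in
-- (c), and an injection between finite sets is onto iff they have equal size;
-- hence (a) ⇔ (c).  A surjection onto K_m is a pseudocovering iff every vertex
-- has exactly one neighbour in every fibre; right multiplication by g is a graph
-- automorphism and Cg = gC, so v has one neighbour in C iff vg has one in gC.
-- This gives (b) ⇒ (a), and for (a) ⇒ (b) the S-component of v = s c is a
-- pseudocovering with the cosets sC as fibres.
module Submission where

open import Level using (0ℓ)
open import Data.Nat using (zero; suc; _*_)
open import Data.Nat.Properties using (1+n≰n)
open import Data.Fin using (Fin; zero; suc; punchOut; combine; remQuot)
open import Data.Fin.Properties
  using (_≟_; any?; punchOut-injective; injective⇒≤; cantor-schröder-bernstein;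
         combine-remQuot; remQuot-combine)
open import Data.Fin.Subset using (Subset; _∈_; ∣_∣; inside; outside)
open import Data.Vec using (_∷_; here; there)
open import Data.Product using (_×_; _,_; ∃-syntax; proj₁; proj₂)
open import Data.Empty using (⊥-elim)
open import Relation.Nullary using (¬_; yes; no)
open import Relation.Binary.PropositionalEquality
  using (_≡_; _≢_; refl; sym; trans; cong; cong₂; subst; module ≡-Reasoning)
open import Function.Bundles using (_⇔_; mk⇔; Equivalence)
open import Function.Definitions using (Injective)
open import Function.Construct.Symmetry using (⇔-sym)
open import Function.Construct.Composition using (_⇔-∘_)
open import Algebra.Bundles using (Group)
open import Algebra.Structures using (IsGroup)
open import Defs

open Equivalence using (to; from)

rank : ∀ {n} (p : Subset n) (x : Fin n) → x ∈ p → Fin ∣ p ∣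
rank (inside ∷ p)  zero    here      = zero
rank (inside ∷ p)  (suc x) (there h) = suc (rank p x h)
rank (outside ∷ p) (suc x) (there h) = rank p x h

select : ∀ {n} (p : Subset n) → Fin ∣ p ∣ → Fin n
select (inside ∷ p)  zero    = zero
select (inside ∷ p)  (suc i) = suc (select p i)
select (outside ∷ p) i       = suc (select p i)

select∈ : ∀ {n} (p : Subset n) (i : Fin ∣ p ∣) → select p i ∈ p
select∈ (inside ∷ p)  zero    = here
select∈ (inside ∷ p)  (suc i) = there (select∈ p i)
select∈ (outside ∷ p) i       = there (select∈ p i)

select-rank : ∀ {n} (p : Subset n) x (h : x ∈ p) → select p (rank p x h) ≡ x
select-rank (inside ∷ p)  zero    here      = refl
select-rank (inside ∷ p)  (suc x) (there h) = cong suc (select-rank p x h)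
select-rank (outside ∷ p) (suc x) (there h) = cong suc (select-rank p x h)

-- Holds for every membership proof h, so rank does not depend on the proof.
rank-select : ∀ {n} (p : Subset n) i (h : select p i ∈ p) → rank p (select p i) h ≡ i
rank-select (inside ∷ p)  zero    here      = refl
rank-select (inside ∷ p)  (suc i) (there h) = cong suc (rank-select p i h)
rank-select (outside ∷ p) i       (there h) = rank-select p i h

rank≡⇔≡select : ∀ {n} (p : Subset n) {x i} (h : x ∈ p) → rank p x h ≡ i ⇔ x ≡ select p i
rank≡⇔≡select p {x} h =
  mk⇔ (λ { refl → sym (select-rank p x h) }) (λ { refl → rank-select p _ h })

select-injective : ∀ {n} (p : Subset n) → Injective _≡_ _≡_ (select p)
select-injective p {i} e =
  trans (sym (rank-select p i (select∈ p i))) (from (rank≡⇔≡select p (select∈ p i)) e)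

-- An injective self-map of Fin n is onto: a missed point would let f squeeze
-- Fin (suc n) injectively into Fin n.
injective⇒surjective : ∀ {n} (f : Fin n → Fin n) → Injective _≡_ _≡_ f →
                       ∀ y → ∃[ x ] f x ≡ y
injective⇒surjective {zero}  f f-inj ()
injective⇒surjective {suc n} f f-inj y with any? (λ x → f x ≟ y)
... | yes hit  = hit
... | no  miss = ⊥-elim (1+n≰n (injective⇒≤ squeeze-injective))
  where
  y≢f : ∀ x → y ≢ f x
  y≢f x y≡fx = miss (x , sym y≡fx)

  squeeze : Fin (suc n) → Fin n
  squeeze x = punchOut (y≢f x)

  squeeze-injective : Injective _≡_ _≡_ squeeze
  squeeze-injective e = f-inj (punchOut-injective (y≢f _) (y≢f _) e)

injection-onto⇔equal-size : ∀ {m n} {f : Fin m → Fin n} → Injective _≡_ _≡_ f →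
                            (∀ y → ∃[ x ] f x ≡ y) ⇔ m ≡ n
injection-onto⇔equal-size {m} {n} {f} f-inj = mk⇔ onto⇒equal equal⇒onto
  where
  -- a choice of preimages is a section of f, hence injective
  onto⇒equal : (∀ y → ∃[ x ] f x ≡ y) → m ≡ n
  onto⇒equal onto = cantor-schröder-bernstein f-inj section-injective
    where
    section-injective : Injective _≡_ _≡_ (λ y → proj₁ (onto y))
    section-injective {y} {y'} e =
      trans (sym (proj₂ (onto y))) (trans (cong f e) (proj₂ (onto y')))

  equal⇒onto : m ≡ n → ∀ y → ∃[ x ] f x ≡ y
  equal⇒onto refl = injective⇒surjective f f-inj

module _ (G : FiniteGroup) where
  open FiniteGroup G
  open IsGroup isGroup using (assoc; identityˡ; inverseʳ)

  group : Group 0ℓ 0ℓ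
  group = record { isGroup = isGroup }

  open import Algebra.Properties.Group group
    using (∙-cancelʳ; ⁻¹-involutive; ⁻¹-anti-homo-∙;
           //-rightDividesˡ; //-rightDividesʳ; \\-leftDividesˡ; \\-leftDividesʳ)

  -- Right multiplication by g does not change the quotient v w⁻¹, so it is an
  -- automorphism of every Cayley graph.
  rightTranslation-quotient : ∀ v w g → (v ∙ g) ∙ (w ∙ g) ⁻¹ ≡ v ∙ w ⁻¹
  rightTranslation-quotient v w g = begin
    (v ∙ g) ∙ (w ∙ g) ⁻¹      ≡⟨ cong ((v ∙ g) ∙_) (⁻¹-anti-homo-∙ w g) ⟩
    (v ∙ g) ∙ (g ⁻¹ ∙ w ⁻¹)   ≡⟨ assoc v g _ ⟩
    v ∙ (g ∙ (g ⁻¹ ∙ w ⁻¹))   ≡⟨ cong (v ∙_) (\\-leftDividesˡ g (w ⁻¹)) ⟩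
    v ∙ w ⁻¹                  ∎
    where open ≡-Reasoning

  conjugate-commutes : ∀ g c → g ∙ ((g ⁻¹ ∙ c) ∙ (g ⁻¹) ⁻¹) ≡ c ∙ g
  conjugate-commutes g c = begin
    g ∙ ((g ⁻¹ ∙ c) ∙ (g ⁻¹) ⁻¹)  ≡⟨ cong (λ h → g ∙ ((g ⁻¹ ∙ c) ∙ h)) (⁻¹-involutive g) ⟩
    g ∙ ((g ⁻¹ ∙ c) ∙ g)          ≡⟨ sym (assoc g _ g) ⟩
    (g ∙ (g ⁻¹ ∙ c)) ∙ g          ≡⟨ cong (_∙ g) (\\-leftDividesˡ g c) ⟩
    c ∙ g                         ∎
    where open ≡-Reasoning

  factorisation-quotient : ∀ {s c s' c'} → s ∙ c ≡ s' ∙ c' → c ≡ (s ⁻¹ ∙ s') ∙ c'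
  factorisation-quotient {s} {c} {s'} {c'} e = begin
    c                 ≡⟨ sym (\\-leftDividesʳ s c) ⟩
    s ⁻¹ ∙ (s ∙ c)    ≡⟨ cong (s ⁻¹ ∙_) e ⟩
    s ⁻¹ ∙ (s' ∙ c')  ≡⟨ sym (assoc _ s' c') ⟩
    (s ⁻¹ ∙ s') ∙ c'  ∎
    where open ≡-Reasoning

  left-factor-unique : ∀ {s c s' c'} → s ∙ c ≡ s' ∙ c' → c ≡ c' → s ≡ s'
  left-factor-unique {s} {c} {s'} e refl = ∙-cancelʳ c s s' e

  infix 5 _·ʳ_
  _·ʳ_ : (Elt → Set) → Elt → Elt → Set
  (X ·ʳ g) x = ∃[ y ] (X y × x ≡ y ∙ g)

  module _ (C : Sub) (cc : ConjClosed C) where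

    conj-closed : ∀ g {c} → c ∈ C → (g ∙ c) ∙ g ⁻¹ ∈ C
    conj-closed g {c} c∈C = from (cc g ((g ∙ c) ∙ g ⁻¹)) (c , c∈C , refl)

    leftCoset⇔rightCoset : ∀ g x → x ∈[ g · C ] ⇔ ((_∈ C) ·ʳ g) x
    leftCoset⇔rightCoset g x = mk⇔ left⇒right right⇒left
      where
      left⇒right : x ∈[ g · C ] → ((_∈ C) ·ʳ g) x
      left⇒right (c , c∈C , x≡gc) =
        (g ∙ c) ∙ g ⁻¹ , conj-closed g c∈C , trans x≡gc (sym (//-rightDividesˡ g (g ∙ c)))

      right⇒left : ((_∈ C) ·ʳ g) x → x ∈[ g · C ]
      right⇒left (c , c∈C , x≡cg) =
        (g ⁻¹ ∙ c) ∙ (g ⁻¹) ⁻¹ , conj-closed (g ⁻¹) c∈C , trans x≡cg (sym (conjugate-commutes g c))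

    -- Translating the coset gC back by g⁻¹ gives C:  (gC)g⁻¹ = gCg⁻¹ = C.
    translatedCoset⇔C : ∀ g x → ((λ y → y ∈[ g · C ]) ·ʳ g ⁻¹) x ⇔ x ∈ C
    translatedCoset⇔C g x = mk⇔ translate⇒C C⇒translate
      where
      translate⇒C : ((λ y → y ∈[ g · C ]) ·ʳ g ⁻¹) x → x ∈ C
      translate⇒C (y , (c , c∈C , y≡gc) , x≡yg⁻¹) =
        subst (_∈ C) (sym (trans x≡yg⁻¹ (cong (_∙ g ⁻¹) y≡gc))) (conj-closed g c∈C)

      C⇒translate : x ∈ C → ((λ y → y ∈[ g · C ]) ·ʳ g ⁻¹) x
      C⇒translate x∈C with to (cc g x) x∈C
      ... | c , c∈C , x≡gcg⁻¹ = g ∙ c , (c , c∈C , refl) , x≡gcg⁻¹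

  module _ (S : Sub) where

    -- v has exactly one neighbour in the vertex set X of Cay(G,S); a total
    -- perfect code is a set C in which every vertex has exactly one neighbour.
    UniqueNeighbourIn : (Elt → Set) → Elt → Set
    UniqueNeighbourIn X v =
      ∃[ w ] (X w × CayAdj S v w × (∀ w' → X w' → CayAdj S v w' → w' ≡ w))

    uniqueNeighbour-resp : ∀ {X Y : Elt → Set} {v} → (∀ x → X x ⇔ Y x) →
                           UniqueNeighbourIn X v → UniqueNeighbourIn Y v
    uniqueNeighbour-resp X⇔Y (w , Xw , adj , uniq) =
      w , to (X⇔Y w) Xw , adj , λ w' Yw' → uniq w' (from (X⇔Y w') Yw')

    uniqueNeighbour-rightTranslate : ∀ {X v} g →
      UniqueNeighbourIn X v → UniqueNeighbourIn (X ·ʳ g) (v ∙ g)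
    uniqueNeighbour-rightTranslate {v = v} g (w , Xw , adj , uniq) =
      w ∙ g , (w , Xw , refl) ,
      subst (_∈ S) (sym (rightTranslation-quotient v w g)) adj ,
      λ { _ (y , Xy , refl) adj' →
            cong (_∙ g) (uniq y Xy (subst (_∈ S) (rightTranslation-quotient v y g) adj')) }

    Fibre : ∀ {m} → (Elt → Fin m) → Fin m → Elt → Set
    Fibre p j w = p w ≡ j

    -- A pseudocovering onto K_m meets every fibre exactly once in each
    -- neighbourhood: the own fibre by the matching, the others by local bijectivity.
    pseudocovering⇒uniqueNeighbourInFibres : ∀ {m} {p : Elt → Fin m} →
      IsPseudocovering S m p → ∀ u j → UniqueNeighbourIn (Fibre p j) u
    pseudocovering⇒uniqueNeighbourInFibres {p = p} pc u j with p u ≟ j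
    ... | yes refl with IsPseudocovering.matching pc u
    ...   | w , adj , pw , uniq = w , pw , adj , λ w' pw' adj' → uniq w' adj' pw'
    pseudocovering⇒uniqueNeighbourInFibres {p = p} pc u j | no pu≢j
      with IsPseudocovering.locSurj pc u j (λ j≡pu → pu≢j (sym j≡pu))
    ... | w , (adj , pu≢pw) , pw =
      w , pw , adj , λ w' pw' adj' →
        IsPseudocovering.locInj pc u w' w
          (adj' , λ pu≡pw' → pu≢j (trans pu≡pw' pw')) (adj , pu≢pw) (trans pw' (sym pw))

    uniqueNeighbourInFibres⇒pseudocovering : ∀ {m} {p : Elt → Fin m} →
      (∀ j → ∃[ u ] p u ≡ j) → (∀ u j → UniqueNeighbourIn (Fibre p j) u) →
      IsPseudocovering S m p
    uniqueNeighbourInFibres⇒pseudocovering {m} {p} onto unique = record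
      { surjective = onto ; matching = matching ; locInj = locInj ; locSurj = locSurj }
      where
      matching : ∀ u → ∃[ w ] (CayAdj S u w × p w ≡ p u
                   × (∀ w' → CayAdj S u w' → p w' ≡ p u → w' ≡ w))
      matching u with unique u (p u)
      ... | w , pw , adj , uniq = w , adj , pw , λ w' adj' pw' → uniq w' pw' adj'

      locInj : ∀ u w w' → CayAdj S u w × p u ≢ p w → CayAdj S u w' × p u ≢ p w' →
               p w ≡ p w' → w ≡ w'
      locInj u w w' (adj , _) (adj' , _) pw≡pw' with unique u (p w)
      ... | _ , _ , _ , uniq = trans (uniq w refl adj) (sym (uniq w' (sym pw≡pw') adj'))

      locSurj : ∀ u (j : Fin m) → j ≢ p u → ∃[ w ] ((CayAdj S u w × p u ≢ p w) × p w ≡ j)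
      locSurj u j j≢pu with unique u j
      ... | w , pw , adj , _ = w , (adj , λ pu≡pw → j≢pu (trans (sym pw) (sym pu≡pw))) , pw

    module _ (C : Sub) where

      record Factorisation (v : Elt) : Set where
        constructor factorisation
        field
          left       : Elt
          right      : Elt
          left∈S     : left ∈ S
          right∈C    : right ∈ C
          factorises : v ≡ left ∙ right

      Factorisable : Set
      Factorisable = ∀ v → Factorisation v

      UniqueFactorisation : Set
      UniqueFactorisation = ∀ {s c s' c'} → s ∈ S → c ∈ C → s' ∈ S → c' ∈ C →
                            s ∙ c ≡ s' ∙ c' → s ≡ s' × c ≡ c'

      TranslatesDisjoint : Set
      TranslatesDisjoint =
        ¬ (∃[ x ] (x ∈ C × ∃[ s ] ∃[ t ] ∃[ c ]
             (s ∈ S × t ∈ S × s ∙ t ≢ ε × c ∈ C × x ≡ (s ∙ t) ∙ c)))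

      factor-adjacent : ∀ {s} c → s ∈ S → CayAdj S (s ∙ c) c
      factor-adjacent {s} c s∈S = subst (_∈ S) (sym (//-rightDividesʳ c s)) s∈S

      tpc⇔factorisation : IsTotalPerfectCode S C ⇔ (UniqueFactorisation × Factorisable)
      tpc⇔factorisation = mk⇔ code⇒factorisation factorisation⇒code
        where
        factorisable : IsTotalPerfectCode S C → Factorisable
        factorisable tpc v with tpc v
        ... | c , c∈C , adj , _ = factorisation (v ∙ c ⁻¹) c adj c∈C (sym (//-rightDividesˡ c v))

        unique : IsTotalPerfectCode S C → UniqueFactorisation
        unique tpc {s} {c} {s'} {c'} s∈S c∈C s'∈S c'∈C e with tpc (s ∙ c)
        ... | _ , _ , _ , uniq = left-factor-unique e c≡c' , c≡c'
          where
          adj' : CayAdj S (s ∙ c) c'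
          adj' = subst (λ v → CayAdj S v c') (sym e) (factor-adjacent c' s'∈S)
          c≡c' : c ≡ c'
          c≡c' = trans (uniq c c∈C (factor-adjacent c s∈S)) (sym (uniq c' c'∈C adj'))

        code⇒factorisation : IsTotalPerfectCode S C → UniqueFactorisation × Factorisable
        code⇒factorisation tpc = unique tpc , factorisable tpc

        factorisation⇒code : UniqueFactorisation × Factorisable → IsTotalPerfectCode S C
        factorisation⇒code (uf , fact) v with fact v
        ... | factorisation s c s∈S c∈C v≡sc =
          c , c∈C , subst (λ u → CayAdj S u c) (sym v≡sc) (factor-adjacent c s∈S) ,
          λ c' c'∈C adj' →
            sym (proj₂ (uf s∈S c∈C adj' c'∈C (trans (sym v≡sc) (sym (//-rightDividesˡ c' v)))))

      -- For S = S⁻¹, unique factorisation is the disjointness condition: two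
      -- factorisations s c = s' c' with c ≠ c' exhibit c ∈ (s⁻¹ s') C.
      uniqueFactorisation⇔disjoint : (∀ {s} → s ∈ S → s ⁻¹ ∈ S) →
                                     UniqueFactorisation ⇔ TranslatesDisjoint
      uniqueFactorisation⇔disjoint inv = mk⇔ unique⇒disjoint disjoint⇒unique
        where
        unique⇒disjoint : UniqueFactorisation → TranslatesDisjoint
        unique⇒disjoint uf (x , x∈C , s , t , c , s∈S , t∈S , st≢ε , c∈C , x≡stc) =
          st≢ε (trans (cong (s ∙_) (sym s⁻¹≡t)) (inverseʳ s))
          where
          s⁻¹≡t : s ⁻¹ ≡ t
          s⁻¹≡t = proj₁ (uf (inv s∈S) x∈C t∈S c∈C s⁻¹x≡tc)
            where
            s⁻¹x≡tc : s ⁻¹ ∙ x ≡ t ∙ c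
            s⁻¹x≡tc = trans (cong (s ⁻¹ ∙_) (trans x≡stc (assoc s t c)))
                            (\\-leftDividesʳ s (t ∙ c))

        disjoint⇒unique : TranslatesDisjoint → UniqueFactorisation
        disjoint⇒unique disjoint {s} {c} {s'} {c'} s∈S c∈C s'∈S c'∈C e with c ≟ c'
        ... | yes c≡c' = left-factor-unique e c≡c' , c≡c'
        ... | no c≢c' = ⊥-elim (disjoint (c , c∈C , s ⁻¹ , s' , c' , inv s∈S , s'∈S ,
                                          quotient≢ε , c'∈C , factorisation-quotient e))
          where
          quotient≢ε : s ⁻¹ ∙ s' ≢ ε
          quotient≢ε q = c≢c' (trans (factorisation-quotient e)
                                      (trans (cong (_∙ c') q) (identityˡ c')))

      -- k ↦ s c enumerates the products of S × C, where k = combine (rank c) (rank s).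
      multiplyPair : Fin ∣ C ∣ × Fin ∣ S ∣ → Elt
      multiplyPair ij = select S (proj₂ ij) ∙ select C (proj₁ ij)

      multiply : Fin (∣ C ∣ * ∣ S ∣) → Elt
      multiply k = multiplyPair (remQuot {∣ C ∣} ∣ S ∣ k)

      multiply-injective : UniqueFactorisation → Injective _≡_ _≡_ multiply
      multiply-injective uf {k} {k'} e
        with uf (select∈ S _) (select∈ C _) (select∈ S _) (select∈ C _) e
      ... | s≡s' , c≡c' =
        trans (sym (combine-remQuot {∣ C ∣} ∣ S ∣ k))
          (trans (cong₂ combine (select-injective C c≡c') (select-injective S s≡s'))
                 (combine-remQuot {∣ C ∣} ∣ S ∣ k'))

      multiply-onto⇔factorisable : (∀ v → ∃[ k ] multiply k ≡ v) ⇔ Factorisable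
      multiply-onto⇔factorisable = mk⇔ onto⇒factorisable factorisable⇒onto
        where
        onto⇒factorisable : (∀ v → ∃[ k ] multiply k ≡ v) → Factorisable
        onto⇒factorisable onto v with onto v
        ... | k , e = factorisation _ _ (select∈ S _) (select∈ C _) (sym e)

        factorisable⇒onto : Factorisable → ∀ v → ∃[ k ] multiply k ≡ v
        factorisable⇒onto fact v with fact v
        ... | factorisation s c s∈S c∈C v≡sc = combine i j , (begin
          multiply (combine i j)     ≡⟨ cong multiplyPair (remQuot-combine i j) ⟩
          select S j ∙ select C i    ≡⟨ cong₂ _∙_ (select-rank S s s∈S) (select-rank C c c∈C) ⟩
          s ∙ c                      ≡⟨ sym v≡sc ⟩
          v                          ∎)
          where
          open ≡-Reasoning
          i = rank C c c∈C
          j = rank S s s∈S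

      -- (a) ⇔ (c): both say that multiplication S × C → G is bijective.
      tpc⇔counting : (∀ {s} → s ∈ S → s ⁻¹ ∈ S) →
                     IsTotalPerfectCode S C ⇔ CountingCondition S C
      tpc⇔counting inv = mk⇔ tpc⇒counting counting⇒tpc
        where
        onto⇔size : UniqueFactorisation → (∀ v → ∃[ k ] multiply k ≡ v) ⇔ (∣ C ∣ * ∣ S ∣ ≡ order)
        onto⇔size uf = injection-onto⇔equal-size (multiply-injective uf)

        tpc⇒counting : IsTotalPerfectCode S C → CountingCondition S C
        tpc⇒counting tpc with to tpc⇔factorisation tpc
        ... | uf , fact = to (onto⇔size uf) (from multiply-onto⇔factorisable fact) ,
                          to (uniqueFactorisation⇔disjoint inv) uf

        counting⇒tpc : CountingCondition S C → IsTotalPerfectCode S C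
        counting⇒tpc (size , disjoint) =
          from tpc⇔factorisation (uf , to multiply-onto⇔factorisable (from (onto⇔size uf) size))
          where
          uf : UniqueFactorisation
          uf = from (uniqueFactorisation⇔disjoint inv) disjoint

      -- v has exactly one neighbour in C iff v g has exactly one neighbour in gC,
      -- since right multiplication by g is a graph automorphism mapping C onto gC.
      uniqueNeighbourInC⇔inCoset : ConjClosed C → ∀ g v →
        UniqueNeighbourIn (_∈ C) v ⇔ UniqueNeighbourIn (λ x → x ∈[ g · C ]) (v ∙ g)
      uniqueNeighbourInC⇔inCoset cc g v = mk⇔
        (λ u → uniqueNeighbour-resp (λ x → ⇔-sym (leftCoset⇔rightCoset C cc g x))
                 (uniqueNeighbour-rightTranslate g u))
        (λ u → subst (UniqueNeighbourIn (_∈ C)) (//-rightDividesʳ g v)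
                 (uniqueNeighbour-resp (translatedCoset⇔C C cc g)
                   (uniqueNeighbour-rightTranslate (g ⁻¹) u)))

      -- (b) ⇒ (a): the neighbours of v in C correspond to those of v g in the fibre gC.
      pseudocovering⇒tpc : ConjClosed C → HasPseudocoveringWithFibre S C →
                           IsTotalPerfectCode S C
      pseudocovering⇒tpc cc (p , pc , g , _ , j , gC-fibre) v =
        from (uniqueNeighbourInC⇔inCoset cc g v)
          (uniqueNeighbour-resp (λ x → ⇔-sym (gC-fibre x))
            (pseudocovering⇒uniqueNeighbourInFibres pc (v ∙ g) j))

      -- (a) ⇒ (b): the pseudocovering records the S-component of v = s c.
      module _ (cc : ConjClosed C) (tpc : IsTotalPerfectCode S C) where
        open Factorisation

        uniqueness : UniqueFactorisation
        uniqueness = proj₁ (to tpc⇔factorisation tpc)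

        factorise : Factorisable
        factorise = proj₂ (to tpc⇔factorisation tpc)

        component-coset : ∀ {g} → g ∈ S → ∀ x → left (factorise x) ≡ g ⇔ x ∈[ g · C ]
        component-coset g∈S x = mk⇔
          (λ { refl → right (factorise x) , right∈C (factorise x) , factorises (factorise x) })
          (λ (c , c∈C , x≡gc) → proj₁ (uniqueness (left∈S (factorise x)) (right∈C (factorise x))
                                          g∈S c∈C (trans (sym (factorises (factorise x))) x≡gc)))

        projection : Elt → Fin ∣ S ∣
        projection v = rank S (left (factorise v)) (left∈S (factorise v))

        fibre⇔coset : ∀ j x → Fibre projection j x ⇔ x ∈[ select S j · C ]
        fibre⇔coset j x =
          component-coset (select∈ S j) x ⇔-∘ rank≡⇔≡select S (left∈S (factorise x))

        projection-onto : ∀ j → ∃[ u ] projection u ≡ j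
        projection-onto j =
          select S j ∙ right (factorise ε) ,
          from (fibre⇔coset j _) (right (factorise ε) , right∈C (factorise ε) , refl)

        -- u has one neighbour in the coset gC because u g⁻¹ has one in C.
        uniqueNeighbourInFibres : ∀ u j → UniqueNeighbourIn (Fibre projection j) u
        uniqueNeighbourInFibres u j =
          uniqueNeighbour-resp (λ x → ⇔-sym (fibre⇔coset j x))
            (subst (UniqueNeighbourIn (λ x → x ∈[ g · C ])) (//-rightDividesˡ g u)
              (to (uniqueNeighbourInC⇔inCoset cc g (u ∙ g ⁻¹)) (tpc (u ∙ g ⁻¹))))
          where
          g : Elt
          g = select S j

        tpc⇒pseudocovering : HasPseudocoveringWithFibre S C
        tpc⇒pseudocovering =
          projection ,
          uniqueNeighbourInFibres⇒pseudocovering projection-onto uniqueNeighbourInFibres ,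
          select S j₀ , select∈ S j₀ , j₀ , λ x → ⇔-sym (fibre⇔coset j₀ x)
          where
          j₀ : Fin ∣ S ∣
          j₀ = projection ε

theorem3p3 : (G : FiniteGroup) → let open FiniteGroup G in
    (S C : Sub) → IsConnectionSet S → ConjClosed C →
    (IsTotalPerfectCode S C ⇔ HasPseudocoveringWithFibre S C)
    × (IsTotalPerfectCode S C ⇔ CountingCondition S C)
theorem3p3 G S C (_ , S⁻¹≡S) cc =
  mk⇔ (tpc⇒pseudocovering G S C cc) (pseudocovering⇒tpc G S C cc) ,
  tpc⇔counting G S C (λ {s} → to (S⁻¹≡S s))
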